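{- Let $G$ be a triangular grid graph, let $G'$ be a boundary subdivision of $G$, and let $\vec{G'}$ be any smart orientation of $G'$. Then $\vec{G'}$ contains no directed cycle.
   Context: The triangular tiling graph $T^\infty$ has vertices $(x,y)\in\mathbb{Z}^2$ placed at $(x+y/2, y\sqrt3/2)$, adjacent iff at Euclidean distance $1$; its triangular faces are cells. A triangular grid graph $G$ is obtained by specifying finitely many cells and taking all edges bounding them (and their endpoints). A cell belongs to $G$ if all its edges are in $G$. A boundary edge is an edge of $G$ lying on a cell of $T^\infty$ not belonging to $G$ (it then lies on exactly one cell of $G$); a boundary cell is a cell of $G$ incident to at least one boundary edge. Subdividing a cell means adding a new vertex (its center) inside it adjacent to exactly the three vertices of the cell. A boundary subdivision of $G$ is obtained by subdividing some set of boundary cells of $G$ only. Each cell is either upward (vertices: top $t$, bottom-left $l$, bottom-right $r$) or downward (vertices: top-left $p$, top-right $q$, bottom $s$). Types of boundary edges: for an upward cell of $G$, its bottom, left and right sides, when boundary edges, have types S, NW, NE respectively; for a downward cell of $G$, its top, left and right sides, when boundary edges, have types N, SW, SE respectively. The property set of a boundary cell is the set of types of its boundary edges. A smart orientation of a boundary subdivision $G'$ of $G$ is an orientation such that: (1) every edge of $G$ (grid edge) that is horizontal is directed from left to right, and every non-horizontal edge of $G$ is directed from its higher endpoint to its lower endpoint; (2) for each subdivided cell with center $z$, the three edges at $z$ are directed according to one of the following six types, chosen to correspond to some element of the cell's property set (NW$\to$A, NE$\to$B, S$\to$C, SE$\to$a, SW$\to$b, N$\to$c): for an upward cell, type A: $t\to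 z$, $z\to l$, $z\to r$; type B: $t\to z$, $l\to z$, $r\to z$; type C: $t\to z$, $l\to z$, $z\to r$; for a downward cell, type a: $p\to z$, $q\to z$, $z\to s$; type b: $z\to p$, $z\to q$, $z\to s$; type c: $p\to z$, $z\to q$, $z\to s$. -}

module Defs where

open import Data.Integer using (ℤ; _+_; _<_; 1ℤ)
open import Data.Product using (_×_; _,_; proj₁; proj₂; Σ; ∃; ∃-syntax)
open import Data.Sum using (_⊎_)
open import Data.Empty using (⊥)
open import Data.List using (List)
open import Data.List.Membership.Propositional using (_∈_)
open import Relation.Nullary using (¬_)
open import Relation.Binary.PropositionalEquality using (_≡_)
open import Relation.Binary.Construct.Closure.Transitive using (TransClosure)

-- Vertices of the triangular tiling T^∞: (x , y) ∈ ℤ², drawn at (x + y/2, y√3/2).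
Pt : Set
Pt = ℤ × ℤ

-- Cells of T^∞.
--   up x y   : upward cell,   l = (x , y),     r = (x+1 , y),   t = (x , y+1)
--   down x y : downward cell, p = (x , y+1),   q = (x+1 , y+1), s = (x+1 , y)
data Cell : Set where
  up   : ℤ → ℤ → Cell
  down : ℤ → ℤ → Cell

tC lC rC : ℤ → ℤ → Pt
tC x y = (x , y + 1ℤ)
lC x y = (x , y)
rC x y = (x + 1ℤ , y)

pC qC sC : ℤ → ℤ → Pt
pC x y = (x , y + 1ℤ)
qC x y = (x + 1ℤ , y + 1ℤ)
sC x y = (x + 1ℤ , y)

data EType : Set where
  S NW NE N SW SE : EType

data SideOf : Cell → EType → Pt → Pt → Set where
  up-S   : ∀ {x y} → SideOf (up x y) S  (lC x y) (rC x y)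
  up-NW  : ∀ {x y} → SideOf (up x y) NW (lC x y) (tC x y)
  up-NE  : ∀ {x y} → SideOf (up x y) NE (tC x y) (rC x y)
  down-N  : ∀ {x y} → SideOf (down x y) N  (pC x y) (qC x y)
  down-SW : ∀ {x y} → SideOf (down x y) SW (pC x y) (sC x y)
  down-SE : ∀ {x y} → SideOf (down x y) SE (qC x y) (sC x y)

IsSide : Cell → Pt → Pt → Set
IsSide c u v = Σ EType λ τ → SideOf c τ u v ⊎ SideOf c τ v u

data Corner : Cell → Pt → Set where
  c-t : ∀ {x y} → Corner (up x y) (tC x y)
  c-l : ∀ {x y} → Corner (up x y) (lC x y)
  c-r : ∀ {x y} → Corner (up x y) (rC x y)
  c-p : ∀ {x y} → Corner (down x y) (pC x y)
  c-q : ∀ {x y} → Corner (down x y) (qC x y)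
  c-s : ∀ {x y} → Corner (down x y) (sC x y)

-- A triangular grid graph G is specified by a finite list L of cells;
-- its edges are all edges bounding the specified cells.
GEdge : List Cell → Pt → Pt → Set
GEdge L u v = ∃[ c ] (c ∈ L × IsSide c u v)

InG : List Cell → Cell → Set
InG L c = ∀ u v → IsSide c u v → GEdge L u v

BoundaryEdge : List Cell → Pt → Pt → Set
BoundaryEdge L u v = GEdge L u v × ∃[ c ] (IsSide c u v × ¬ InG L c)

BoundaryCell : List Cell → Cell → Set
BoundaryCell L c = InG L c × ∃[ u ] ∃[ v ] (IsSide c u v × BoundaryEdge L u v)

-- τ belongs to the property set of the cell c of G.
InPropSet : List Cell → Cell → EType → Set
InPropSet L c τ = ∃[ u ] ∃[ v ] (SideOf c τ u v × BoundaryEdge L u v)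

data V' : Set where
  grid : Pt → V'
  ctr  : Cell → V'

-- Edges of the boundary subdivision G' of G, where Sub is the set of
-- subdivided cells.
data Edge' (L : List Cell) (Sub : Cell → Set) : V' → V' → Set where
  gg : ∀ {u v} → GEdge L u v → Edge' L Sub (grid u) (grid v)
  cg : ∀ {c v} → Sub c → Corner c v → Edge' L Sub (ctr c) (grid v)
  gc : ∀ {c v} → Sub c → Corner c v → Edge' L Sub (grid v) (ctr c)

record IsOrientation (L : List Cell) (Sub : Cell → Set) (Arc : V' → V' → Set) : Set where
  field
    arc-edge : ∀ {a b} → Arc a b → Edge' L Sub a b
    arc-total : ∀ {a b} → Edge' L Sub a b → Arc a b ⊎ Arc b a
    arc-antisym : ∀ {a b} → Arc a b → Arc b a → ⊥

Prescribed : Pt → Pt → Set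
Prescribed (x₁ , y₁) (x₂ , y₂) = (y₁ ≡ y₂ × x₂ ≡ x₁ + 1ℤ) ⊎ y₂ < y₁

-- The six center-edge patterns, indexed by the boundary-edge type they
-- correspond to (NW→A, NE→B, S→C, SE→a, SW→b, N→c).
Pattern : (V' → V' → Set) → Cell → EType → Set
Pattern Arc (up x y) NW = Arc (grid (tC x y)) (ctr (up x y)) × Arc (ctr (up x y)) (grid (lC x y)) × Arc (ctr (up x y)) (grid (rC x y))
Pattern Arc (up x y) NE = Arc (grid (tC x y)) (ctr (up x y)) × Arc (grid (lC x y)) (ctr (up x y)) × Arc (grid (rC x y)) (ctr (up x y))
Pattern Arc (up x y) S  = Arc (grid (tC x y)) (ctr (up x y)) × Arc (grid (lC x y)) (ctr (up x y)) × Arc (ctr (up x y)) (grid (rC x y))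
Pattern Arc (down x y) SE = Arc (grid (pC x y)) (ctr (down x y)) × Arc (grid (qC x y)) (ctr (down x y)) × Arc (ctr (down x y)) (grid (sC x y))
Pattern Arc (down x y) SW = Arc (ctr (down x y)) (grid (pC x y)) × Arc (ctr (down x y)) (grid (qC x y)) × Arc (ctr (down x y)) (grid (sC x y))
Pattern Arc (down x y) N  = Arc (grid (pC x y)) (ctr (down x y)) × Arc (ctr (down x y)) (grid (qC x y)) × Arc (ctr (down x y)) (grid (sC x y))
Pattern Arc _ _ = ⊥

record IsSmart (L : List Cell) (Sub : Cell → Set) (Arc : V' → V' → Set) : Set where
  field
    orientation : IsOrientation L Sub Arc
    grid-dir : ∀ {u v} → GEdge L u v → Prescribed u v → Arc (grid u) (grid v)
    center-dir : ∀ c → Sub c → ∃[ τ ] (InPropSet L c τ × Pattern Arc c τ)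

HasDirectedCycle : (V' → V' → Set) → Set
HasDirectedCycle Arc = ∃[ a ] TransClosure Arc a a

module Submission where

-- Measure every grid vertex (x , y) by the potential 2(x − y).
-- Condition (1) makes every grid arc run from lower to higher potential:
-- horizontal arcs gain 2, arcs down-left gain 2 and arcs down-right gain 4.
-- A centre z of a subdivided cell has only corners of that cell as
-- neighbours, and in each of the six admissible patterns the corners with an
-- arc into z all have smaller potential than the corners with an arc out of
-- z (the pattern "splits" the corners at a threshold).  Hence every step
-- grid → grid and every detour grid → centre → grid strictly increases the
-- potential.  Since centres are never adjacent to each other, a directed
-- cycle can be rotated to start at a grid vertex and then contracted to a
-- cycle of such steps, along which the potential would strictly increase
-- back to its starting value, which is absurd.

open import Defs
open import Data.List using (List)
open import Data.Integer using (ℤ; _+_; _-_; _<_; _<?_; 1ℤ; -1ℤ; +_)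
open import Data.Integer.Properties using (+-monoʳ-<; +-identityʳ; <-trans; <-irrefl)
open import Data.Integer.Tactic.RingSolver using (solve-∀)
open import Data.Product using (_×_; _,_; ∃-syntax)
open import Data.Sum using (_⊎_; inj₁; inj₂)
open import Data.Empty using (⊥-elim)
open import Relation.Nullary using (¬_)
open import Relation.Nullary.Decidable using (True; toWitness)
open import Relation.Binary.PropositionalEquality using (_≡_; refl; sym; subst)
open import Relation.Binary.Construct.Closure.Transitive using (TransClosure; [_]; _∷_; _∷ʳ_)

module _ {A : Set} (R : A → A → Set) (f : A → ℤ) (increasing : ∀ {a b} → R a b → f a < f b) where

  increasing⁺ : ∀ {a b} → TransClosure R a b → f a < f b
  increasing⁺ [ r ] = increasing r
  increasing⁺ (r ∷ rs) = <-trans (increasing r) (increasing⁺ rs)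

  acyclic-by-measure : ∀ {a} → ¬ TransClosure R a a
  acyclic-by-measure cycle = <-irrefl refl (increasing⁺ cycle)

ordered : ∀ {i j} {_ : True (i <? j)} → i < j
ordered {_} {_} {i<j} = toWitness i<j

potential : Pt → ℤ
potential (x , y) = (x - y) + (x - y)

-- The corners of a cell lie at three potential levels above its top(-left)
-- corner (x , y+1): levels 0, 2, 4.
reference : Cell → ℤ
reference (up x y)   = potential (x , y + 1ℤ)
reference (down x y) = potential (x , y + 1ℤ)

level : ∀ {c w} → Corner c w → ℤ
level c-t = + 0
level c-l = + 2
level c-r = + 4
level c-p = + 0
level c-q = + 2
level c-s = + 4

-- The other corner positions relative to (x , y+1), by normalising the
-- potentials 2(x − y) (written out, as the ring solver needs).
one-row-down : ∀ x y → (x - y) + (x - y) ≡ ((x - (y + 1ℤ)) + (x - (y + 1ℤ))) + + 2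
one-row-down = solve-∀

one-column-right : ∀ x y → ((x + 1ℤ) - (y + 1ℤ)) + ((x + 1ℤ) - (y + 1ℤ)) ≡ ((x - (y + 1ℤ)) + (x - (y + 1ℤ))) + + 2
one-column-right = solve-∀

diagonal-down-right : ∀ x y → ((x + 1ℤ) - y) + ((x + 1ℤ) - y) ≡ ((x - (y + 1ℤ)) + (x - (y + 1ℤ))) + + 4
diagonal-down-right = solve-∀

corner-potential : ∀ {c w} (k : Corner c w) → potential w ≡ reference c + level k
corner-potential (c-t {x} {y}) = sym (+-identityʳ (potential (x , y + 1ℤ)))
corner-potential (c-l {x} {y}) = one-row-down x y
corner-potential (c-r {x} {y}) = diagonal-down-right x y
corner-potential (c-p {x} {y}) = sym (+-identityʳ (potential (x , y + 1ℤ)))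
corner-potential (c-q {x} {y}) = one-column-right x y
corner-potential (c-s {x} {y}) = diagonal-down-right x y

climb : ∀ c {u v} (k : Corner c u) (k′ : Corner c v) → level k < level k′ → potential u < potential v
climb c k k′ k<k′ rewrite corner-potential k | corner-potential k′ = +-monoʳ-< (reference c) k<k′

Rising : Pt → Pt → Set
Rising u v = Prescribed u v × potential u < potential v

lower-row : ∀ y → y < y + 1ℤ
lower-row y = subst (_< y + 1ℤ) (+-identityʳ y) (+-monoʳ-< y ordered)

side-rising : ∀ {c τ u v} → SideOf c τ u v → Rising u v ⊎ Rising v u
side-rising (up-S {x} {y})    = inj₁ (inj₁ (refl , refl) , climb (up x y) c-l c-r ordered)
side-rising (up-NW {x} {y})   = inj₂ (inj₂ (lower-row y) , climb (up x y) c-t c-l ordered)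
side-rising (up-NE {x} {y})   = inj₁ (inj₂ (lower-row y) , climb (up x y) c-t c-r ordered)
side-rising (down-N {x} {y})  = inj₁ (inj₁ (refl , refl) , climb (down x y) c-p c-q ordered)
side-rising (down-SW {x} {y}) = inj₁ (inj₂ (lower-row y) , climb (down x y) c-p c-s ordered)
side-rising (down-SE {x} {y}) = inj₁ (inj₂ (lower-row y) , climb (down x y) c-q c-s ordered)

edge-rising : ∀ {c u v} → IsSide c u v → Rising u v ⊎ Rising v u
edge-rising (_ , inj₁ side) = side-rising side
edge-rising (_ , inj₂ side) with side-rising side
... | inj₁ rising = inj₂ rising
... | inj₂ rising = inj₁ rising

edge-sym : ∀ {L u v} → GEdge L u v → GEdge L v u
edge-sym (c , c∈L , τ , inj₁ side) = c , c∈L , τ , inj₂ side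
edge-sym (c , c∈L , τ , inj₂ side) = c , c∈L , τ , inj₁ side

module SmartOrientation (L : List Cell) (Sub : Cell → Set) (Arc : V' → V' → Set) (smart : IsSmart L Sub Arc) where
  open IsSmart smart
  open IsOrientation orientation

  -- Grid arcs point upwards in potential: an arc against the prescribed
  -- direction would coexist with the prescribed arc, contradicting antisymmetry.
  grid-arc-rising : ∀ {u v} → Arc (grid u) (grid v) → potential u < potential v
  grid-arc-rising arc with arc-edge arc
  ... | gg (c , c∈L , side) with edge-rising side
  ...   | inj₁ (_ , u<v) = u<v
  ...   | inj₂ (prescribed , _) = ⊥-elim (arc-antisym arc (grid-dir (edge-sym (c , c∈L , side)) prescribed))

  SplitsAt : Cell → ℤ → Set
  SplitsAt c t = ∀ {w} (k : Corner c w) →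
    (Arc (grid w) (ctr c) × level k < t) ⊎ (Arc (ctr c) (grid w) × t < level k)

  pattern-splits : ∀ c τ → Pattern Arc c τ → ∃[ t ] SplitsAt c t
  pattern-splits (up x y) NW (t→z , z→l , z→r) = + 1 , λ
    { c-t → inj₁ (t→z , ordered) ; c-l → inj₂ (z→l , ordered) ; c-r → inj₂ (z→r , ordered) }
  pattern-splits (up x y) NE (t→z , l→z , r→z) = + 5 , λ
    { c-t → inj₁ (t→z , ordered) ; c-l → inj₁ (l→z , ordered) ; c-r → inj₁ (r→z , ordered) }
  pattern-splits (up x y) S (t→z , l→z , z→r) = + 3 , λ
    { c-t → inj₁ (t→z , ordered) ; c-l → inj₁ (l→z , ordered) ; c-r → inj₂ (z→r , ordered) }
  pattern-splits (down x y) SE (p→z , q→z , z→s) = + 3 , λ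
    { c-p → inj₁ (p→z , ordered) ; c-q → inj₁ (q→z , ordered) ; c-s → inj₂ (z→s , ordered) }
  pattern-splits (down x y) SW (z→p , z→q , z→s) = -1ℤ , λ
    { c-p → inj₂ (z→p , ordered) ; c-q → inj₂ (z→q , ordered) ; c-s → inj₂ (z→s , ordered) }
  pattern-splits (down x y) N (p→z , z→q , z→s) = + 1 , λ
    { c-p → inj₁ (p→z , ordered) ; c-q → inj₂ (z→q , ordered) ; c-s → inj₂ (z→s , ordered) }

  entering-below : ∀ {c t w} → SplitsAt c t → (k : Corner c w) → Arc (grid w) (ctr c) → level k < t
  entering-below splits k w→z with splits k
  ... | inj₁ (_ , below) = below
  ... | inj₂ (z→w , _) = ⊥-elim (arc-antisym w→z z→w)

  leaving-above : ∀ {c t w} → SplitsAt c t → (k : Corner c w) → Arc (ctr c) (grid w) → t < level k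
  leaving-above splits k z→w with splits k
  ... | inj₁ (w→z , _) = ⊥-elim (arc-antisym z→w w→z)
  ... | inj₂ (_ , above) = above

  detour-rising : ∀ {u c v} → Arc (grid u) (ctr c) → Arc (ctr c) (grid v) → potential u < potential v
  detour-rising {c = c} u→z z→v with arc-edge u→z | arc-edge z→v
  ... | gc subdivided ku | cg _ kv with center-dir c subdivided
  ...   | τ , _ , arcs-at-centre with pattern-splits c τ arcs-at-centre
  ...     | _ , splits = climb c ku kv (<-trans (entering-below splits ku u→z) (leaving-above splits kv z→v))

  no-centre-arc : ∀ {c d} → ¬ Arc (ctr c) (ctr d)
  no-centre-arc arc with arc-edge arc
  ... | ()

  GridStep : Pt → Pt → Set
  GridStep u v = Arc (grid u) (grid v) ⊎ ∃[ c ] (Arc (grid u) (ctr c) × Arc (ctr c) (grid v))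

  grid-step-rising : ∀ {u v} → GridStep u v → potential u < potential v
  grid-step-rising (inj₁ arc) = grid-arc-rising arc
  grid-step-rising (inj₂ (_ , u→z , z→v)) = detour-rising u→z z→v

  contract : ∀ {u v} → TransClosure Arc (grid u) (grid v) → TransClosure GridStep u v
  contract [ arc ] = [ inj₁ arc ]
  contract (_∷_ {y = grid w} arc rest) = inj₁ arc ∷ contract rest
  contract (_∷_ {y = ctr c} u→z [ z→v ]) = [ inj₂ (c , u→z , z→v) ]
  contract (_∷_ {y = ctr c} u→z (_∷_ {y = grid w} z→w rest)) = inj₂ (c , u→z , z→w) ∷ contract rest
  contract (_∷_ {y = ctr c} _ (_∷_ {y = ctr d} z→z′ _)) = ⊥-elim (no-centre-arc z→z′)

  rotate : ∀ {a} → TransClosure Arc a a → ∃[ u ] TransClosure Arc (grid u) (grid u)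
  rotate {grid u} cycle = u , cycle
  rotate {ctr c} [ z→z ] = ⊥-elim (no-centre-arc z→z)
  rotate {ctr c} (_∷_ {y = grid v} z→v rest) = v , rest ∷ʳ z→v
  rotate {ctr c} (_∷_ {y = ctr d} z→z′ _) = ⊥-elim (no-centre-arc z→z′)

  acyclic : ∀ {a} → ¬ TransClosure Arc a a
  acyclic cycle with rotate cycle
  ... | _ , grid-cycle = acyclic-by-measure GridStep potential grid-step-rising (contract grid-cycle)

lemma1 : (L : List Cell) (Sub : Cell → Set) →
         (∀ c → Sub c → BoundaryCell L c) →
         (Arc : V' → V' → Set) → IsSmart L Sub Arc →
         ¬ HasDirectedCycle Arc
lemma1 L Sub _ Arc smart (_ , cycle) = SmartOrientation.acyclic L Sub Arc smart cycle
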